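{- Let $\Gamma$ be a context and $A$ a type. If for every possible-world model $\mathcal{M}$ the type $\forall w.\,\llbracket\Gamma\rrbracket_w\to\llbracket A\rrbracket_w$ is inhabited, then there is a term $t:\Gamma\vdash A$ of IKC.
   Context: Metalanguage: constructive type theory with universe $\mathsf{Type}$. Types $A,B::=\iota\mid A\Rightarrow B\mid\Box A$; contexts $\Gamma::=\cdot\mid\Gamma,A\mid\Gamma,\blacksquare$ ($\blacksquare$ a lock). IKC terms: de Bruijn variables ($\mathsf{zero}:(\Gamma,A)\vdash_{var}A$, $\mathsf{succ}\,v:(\Gamma,B)\vdash_{var}A$ for $v:\Gamma\vdash_{var}A$; no variable passes a lock); $\lambda$-abstraction and application as in simply typed lambda calculus; $\Gamma\vdash\mathsf{box}\,t:\Box A$ for $(\Gamma,\blacksquare)\vdash t:A$; $\Gamma\vdash\mathsf{unbox}(t,e):A$ for $\Delta\vdash t:\Box A$ and $e:\Delta\lhd\Gamma$, where $\Delta\lhd\Gamma$ is generated by $\mathsf{nil}:\Gamma\lhd(\Gamma,\blacksquare)$ and $\mathsf{ext}\,e:\Delta\lhd(\Gamma,A)$ for $e:\Delta\lhd\Gamma$. A possible-world model: frame $(W,R_i,R_m)$, $R_i,R_m:W\times W\to\mathsf{Type}$, $R_i$ with $\mathsf{refl}_i,\mathsf{trans}_i$ forming a category; factorization: for $m:w\,R_m\,v$, $i:v\,R_i\,v'$ a world $w'$ with $f_i(m,i):w\,R_i\,w'$, $f_m(m,i):w'\,R_m\,v'$, satisfying $f_i(m,\mathsf{refl}_i)=\mathsf{refl}_i$,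 $f_m(m,\mathsf{refl}_i)=m$, $f_i(m,\mathsf{trans}_i(i,j))=\mathsf{trans}_i(f_i(m,i),f_i(f_m(m,i),j))$, $f_m(m,\mathsf{trans}_i(i,j))=f_m(f_m(m,i),j)$; and valuation $V_\iota:W\to\mathsf{Type}$ with functorial $\mathsf{wk}_\iota:w\,R_i\,w'\to V_{\iota,w}\to V_{\iota,w'}$. Interpretation: $\llbracket\iota\rrbracket_w=V_{\iota,w}$; $\llbracket A\Rightarrow B\rrbracket_w=\forall w'.w\,R_i\,w'\to\llbracket A\rrbracket_{w'}\to\llbracket B\rrbracket_{w'}$; $\llbracket\Box A\rrbracket_w=\forall w'.w\,R_i\,w'\to\forall v.w'\,R_m\,v\to\llbracket A\rrbracket_v$; $\llbracket\cdot\rrbracket_w=\top$; $\llbracket\Gamma,A\rrbracket_w=\llbracket\Gamma\rrbracket_w\times\llbracket A\rrbracket_w$; $\llbracket\Gamma,\blacksquare\rrbracket_w=\Sigma_u\llbracket\Gamma\rrbracket_u\times u\,R_m\,w$. -}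

module Defs where

open import Data.Unit using (⊤; tt)
open import Data.Product using (Σ; _×_; _,_)
open import Relation.Binary.PropositionalEquality using (_≡_)

infixr 7 _⇒_
data Ty : Set where
  ι   : Ty
  _⇒_ : Ty → Ty → Ty
  □_  : Ty → Ty

infixl 6 _`,_
data Ctx : Set where
  ·     : Ctx
  _`,_  : Ctx → Ty → Ctx
  _,🔒  : Ctx → Ctx

-- de Bruijn variables; no variable passes a lock
data _∋_ : Ctx → Ty → Set where
  zero : ∀ {Γ A} → (Γ `, A) ∋ A
  succ : ∀ {Γ A B} → Γ ∋ A → (Γ `, B) ∋ A

data _◁_ : Ctx → Ctx → Set where
  nil : ∀ {Γ} → Γ ◁ (Γ ,🔒)
  ext : ∀ {Δ Γ A} → Δ ◁ Γ → Δ ◁ (Γ `, A)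

data _⊢_ : Ctx → Ty → Set where
  var   : ∀ {Γ A} → Γ ∋ A → Γ ⊢ A
  lam   : ∀ {Γ A B} → (Γ `, A) ⊢ B → Γ ⊢ (A ⇒ B)
  app   : ∀ {Γ A B} → Γ ⊢ (A ⇒ B) → Γ ⊢ A → Γ ⊢ B
  box   : ∀ {Γ A} → (Γ ,🔒) ⊢ A → Γ ⊢ (□ A)
  unbox : ∀ {Γ Δ A} → Δ ⊢ (□ A) → Δ ◁ Γ → Γ ⊢ A

record Model : Set₁ where
  field
    W      : Set
    Ri     : W → W → Set
    Rm     : W → W → Set
    refl-i  : ∀ {w} → Ri w w
    trans-i : ∀ {w w' w''} → Ri w w' → Ri w' w'' → Ri w w''
    trans-i-idˡ : ∀ {w w'} (i : Ri w w') → trans-i refl-i i ≡ i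
    trans-i-idʳ : ∀ {w w'} (i : Ri w w') → trans-i i refl-i ≡ i
    trans-i-assoc : ∀ {w w' w'' w'''} (i : Ri w w') (j : Ri w' w'') (k : Ri w'' w''') →
                    trans-i (trans-i i j) k ≡ trans-i i (trans-i j k)
    fw : ∀ {w v v'} → Rm w v → Ri v v' → W
    fi : ∀ {w v v'} (m : Rm w v) (i : Ri v v') → Ri w (fw m i)
    fm : ∀ {w v v'} (m : Rm w v) (i : Ri v v') → Rm (fw m i) v'
    -- factorization laws, stated as equalities of (world, R_i-edge, R_m-edge) triples
    -- (the equation on f_i/f_m implicitly includes equality of the intermediate worlds)
    factor-refl : ∀ {w v} (m : Rm w v) →
      _≡_ {A = Σ W (λ w' → Ri w w' × Rm w' v)}
        (fw m refl-i , fi m refl-i , fm m refl-i)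
        (w , refl-i , m)
    factor-trans : ∀ {w v v' v''} (m : Rm w v) (i : Ri v v') (j : Ri v' v'') →
      _≡_ {A = Σ W (λ w' → Ri w w' × Rm w' v'')}
        (fw m (trans-i i j) , fi m (trans-i i j) , fm m (trans-i i j))
        (fw (fm m i) j , trans-i (fi m i) (fi (fm m i) j) , fm (fm m i) j)
    Vι    : W → Set
    wk-ι  : ∀ {w w'} → Ri w w' → Vι w → Vι w'
    wk-ι-refl  : ∀ {w} (x : Vι w) → wk-ι refl-i x ≡ x
    wk-ι-trans : ∀ {w w' w''} (i : Ri w w') (j : Ri w' w'') (x : Vι w) →
                 wk-ι (trans-i i j) x ≡ wk-ι j (wk-ι i x)

module _ (M : Model) where
  open Model M

  ⟦_⟧Ty : Ty → W → Set
  ⟦ ι ⟧Ty w = Vι w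
  ⟦ A ⇒ B ⟧Ty w = ∀ {w'} → Ri w w' → ⟦ A ⟧Ty w' → ⟦ B ⟧Ty w'
  ⟦ □ A ⟧Ty w = ∀ {w'} → Ri w w' → ∀ {v} → Rm w' v → ⟦ A ⟧Ty v

  ⟦_⟧Ctx : Ctx → W → Set
  ⟦ · ⟧Ctx w = ⊤
  ⟦ Γ `, A ⟧Ctx w = ⟦ Γ ⟧Ctx w × ⟦ A ⟧Ty w
  ⟦ Γ ,🔒 ⟧Ctx w = Σ W (λ u → ⟦ Γ ⟧Ctx u × Rm u w)

{-# OPTIONS --safe #-}
-- Completeness via a universal model. Its worlds are contexts, R_i relates Γ to Γ' by
-- maps Γ ⊢ - → Γ' ⊢ -, and R_m relates Δ to Γ by maps Δ ⊢ □ - → Γ ⊢ -. In this model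
-- every type is interpreted so that terms can be reflected into it and semantic values
-- reified back to terms (normalisation by evaluation). Reflecting the variables of Γ
-- gives an environment in ⟦ Γ ⟧ at world Γ; the assumed semantic proof of A applied to
-- it is a value in ⟦ A ⟧ at Γ, and reifying it yields the term.
module Submission where

open import Defs
open import Data.Unit using (tt)
open import Data.Product using (∃-syntax; _×_; _,_)
open import Relation.Binary.PropositionalEquality using (refl)

module _ (M : Model) where
  open Model M

  ⟦⟧Ty-mono : ∀ A {w w'} → Ri w w' → ⟦ M ⟧Ty A w → ⟦ M ⟧Ty A w'
  ⟦⟧Ty-mono ι       i x     = wk-ι i x
  ⟦⟧Ty-mono (A ⇒ B) i f j a = f (trans-i i j) a
  ⟦⟧Ty-mono (□ A)   i f j m = f (trans-i i j) m

  ⟦⟧Ctx-mono : ∀ Γ {w w'} → Ri w w' → ⟦ M ⟧Ctx Γ w → ⟦ M ⟧Ctx Γ w'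
  ⟦⟧Ctx-mono ·        i _           = tt
  ⟦⟧Ctx-mono (Γ `, A) i (γ , a)     = ⟦⟧Ctx-mono Γ i γ , ⟦⟧Ty-mono A i a
  ⟦⟧Ctx-mono (Γ ,🔒)  i (u , γ , m) = fw m i , ⟦⟧Ctx-mono Γ (fi m i) γ , fm m i

infix 4 _⊆_
data _⊆_ : Ctx → Ctx → Set where
  base  : · ⊆ ·
  weak  : ∀ {Γ Γ' A} → Γ ⊆ Γ' → Γ ⊆ Γ' `, A
  lift  : ∀ {Γ Γ' A} → Γ ⊆ Γ' → Γ `, A ⊆ Γ' `, A
  lift🔒 : ∀ {Γ Γ'} → Γ ⊆ Γ' → Γ ,🔒 ⊆ Γ' ,🔒

⊆-refl : ∀ {Γ} → Γ ⊆ Γ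
⊆-refl {·}      = base
⊆-refl {Γ `, A} = lift ⊆-refl
⊆-refl {Γ ,🔒}  = lift🔒 ⊆-refl

ren-∋ : ∀ {Γ Γ' A} → Γ ⊆ Γ' → Γ ∋ A → Γ' ∋ A
ren-∋ (weak r) v        = succ (ren-∋ r v)
ren-∋ (lift r) zero     = zero
ren-∋ (lift r) (succ v) = succ (ren-∋ r v)

ren-◁ : ∀ {Δ Γ Γ'} → Δ ◁ Γ → Γ ⊆ Γ' → ∃[ Δ' ] (Δ ⊆ Δ' × Δ' ◁ Γ')
ren-◁ e       (weak r)  with ren-◁ e r
... | Δ' , r' , e' = Δ' , r' , ext e'
ren-◁ (ext e) (lift r)  with ren-◁ e r
... | Δ' , r' , e' = Δ' , r' , ext e'
ren-◁ nil     (lift🔒 r) = _ , r , nil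

ren : ∀ {Γ Γ' A} → Γ ⊆ Γ' → Γ ⊢ A → Γ' ⊢ A
ren r (var v)     = var (ren-∋ r v)
ren r (lam t)     = lam (ren (lift r) t)
ren r (app t u)   = app (ren r t) (ren r u)
ren r (box t)     = box (ren (lift🔒 r) t)
ren r (unbox t e) with ren-◁ e r
... | Δ' , r' , e' = unbox (ren r' t) e'

-- With relations given by term maps, every category and factorisation law holds
-- definitionally; factorisation is trivial: f_i is the identity and f_m absorbs i.
termModel : Model
termModel = record
  { W             = Ctx
  ; Ri            = λ Γ Γ' → ∀ A → Γ ⊢ A → Γ' ⊢ A
  ; Rm            = λ Δ Γ → ∀ A → Δ ⊢ (□ A) → Γ ⊢ A
  ; refl-i        = λ A t → t
  ; trans-i       = λ i j A t → j A (i A t)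
  ; trans-i-idˡ   = λ i → refl
  ; trans-i-idʳ   = λ i → refl
  ; trans-i-assoc = λ i j k → refl
  ; fw            = λ {w} m i → w
  ; fi            = λ m i A t → t
  ; fm            = λ m i A t → i A (m A t)
  ; factor-refl   = λ m → refl
  ; factor-trans  = λ m i j → refl
  ; Vι            = λ Γ → Γ ⊢ ι
  ; wk-ι          = λ i t → i ι t
  ; wk-ι-refl     = λ x → refl
  ; wk-ι-trans    = λ i j x → refl
  }

open Model termModel using (Ri; Rm; refl-i)

Ri-wk : ∀ {Γ B} → Ri Γ (Γ `, B)
Ri-wk A = ren (weak ⊆-refl)

Rm-unbox : ∀ {Γ} → Rm Γ (Γ ,🔒)
Rm-unbox A t = unbox t nil

mutual
  reflect : ∀ A {Γ} → Γ ⊢ A → ⟦ termModel ⟧Ty A Γ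
  reflect ι       t     = t
  reflect (A ⇒ B) t i a = reflect B (app (i _ t) (reify A a))
  reflect (□ A)   t i m = reflect A (m A (i _ t))

  reify : ∀ A {Γ} → ⟦ termModel ⟧Ty A Γ → Γ ⊢ A
  reify ι       x = x
  reify (A ⇒ B) f = lam (reify B (f Ri-wk (reflect A (var zero))))
  reify (□ A)   f = box (reify A (f refl-i Rm-unbox))

reflectCtx : ∀ Γ → ⟦ termModel ⟧Ctx Γ Γ
reflectCtx ·        = tt
reflectCtx (Γ `, A) = ⟦⟧Ctx-mono termModel Γ Ri-wk (reflectCtx Γ) , reflect A (var zero)
reflectCtx (Γ ,🔒)  = Γ , reflectCtx Γ , Rm-unbox

theorem4p3 : (Γ : Ctx) (A : Ty) →
    ((M : Model) → (w : Model.W M) → ⟦ M ⟧Ctx Γ w → ⟦ M ⟧Ty A w) →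
    Γ ⊢ A
theorem4p3 Γ A valid = reify A (valid termModel Γ (reflectCtx Γ))
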